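{- For all positive integers $n,t$ and $q\ge 2$, the Hamming graph $H(tn,q)$ covers the multigraph $tH(n,q)$.
   Context: The Hamming graph $H(n,q)$ has vertex set $\mathbb{Z}_q^n$; two vertices are adjacent iff they differ in exactly one coordinate. For a multigraph $G$, $tG$ denotes the multigraph on the same vertex set in which every edge (and loop) of $G$ has multiplicity $t$ times its multiplicity in $G$. A multigraph $G=(V,E)$ covers a multigraph $H=(U,W)$ if there is a surjective map $\varphi:V\to U$ such that for every $v\in V$ the multiset of $\varphi(u)$ over the neighbors $u$ of $v$ (with multiplicity) equals the multiset of neighbors of $\varphi(v)$ in $H$ (with multiplicity). -}

module Defs where

open import Data.Nat using (ℕ; zero; suc; _+_; _*_)
open import Data.Fin using (Fin)
open import Data.Fin.Properties using () renaming (_≟_ to _≟ᶠ_)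
open import Data.Vec using (Vec; []; _∷_)
open import Data.Vec.Properties using (≡-dec)
open import Data.List using (List; []; _∷_; map; concatMap; allFin)
open import Data.Nat.ListAction using (sum)
open import Data.Product using (Σ; ∃; _×_; _,_)
open import Relation.Nullary using (yes; no)
open import Relation.Binary.PropositionalEquality using (_≡_)
open import Relation.Binary.Definitions using (DecidableEquality)

-- A finite multigraph: a vertex type with decidable equality, a list
-- enumerating every vertex exactly once, and an edge-multiplicity function
-- (adj v u = number of edges between v and u; loops counted as in adj v v).
record FinMultigraph : Set₁ where
  field
    V     : Set
    _≟V_  : DecidableEquality V
    elems : List V
    adj   : V → V → ℕ

open FinMultigraph public

_·_ : ℕ → FinMultigraph → FinMultigraph
t · G = record { V = V G ; _≟V_ = _≟V_ G ; elems = elems G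
               ; adj = λ v u → t * adj G v u }

-- G covers H: a surjection φ such that for every v, the multiset of φ(u)
-- over neighbours u of v (with multiplicity) equals the multiset of
-- neighbours of φ(v) in H; i.e. for each w, the total multiplicity of
-- neighbours u of v with φ u = w equals adj H (φ v) w.
neighbourCount : (G H : FinMultigraph) → (V G → V H) → V G → V H → ℕ
neighbourCount G H φ v w =
  sum (map (λ u → count u) (elems G))
  where
  count : V G → ℕ
  count u with _≟V_ H (φ u) w
  ... | yes _ = adj G v u
  ... | no  _ = 0

Covers : FinMultigraph → FinMultigraph → Set
Covers G H = Σ (V G → V H) λ φ →
  ((w : V H) → ∃ λ v → φ v ≡ w) ×
  ((v : V G) (w : V H) → neighbourCount G H φ v w ≡ adj H (φ v) w)

allVecs : (n q : ℕ) → List (Vec (Fin q) n)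
allVecs zero    q = [] ∷ []
allVecs (suc n) q = concatMap (λ x → map (x ∷_) (allVecs n q)) (allFin q)

hdist : ∀ {n q} → Vec (Fin q) n → Vec (Fin q) n → ℕ
hdist []       []       = 0
hdist (x ∷ xs) (y ∷ ys) with x ≟ᶠ y
... | yes _ = hdist xs ys
... | no  _ = suc (hdist xs ys)

hamAdj : ∀ {n q} → Vec (Fin q) n → Vec (Fin q) n → ℕ
hamAdj u v with hdist u v
... | 1 = 1
... | _ = 0

Hamming : ℕ → ℕ → FinMultigraph
Hamming n q = record { V = Vec (Fin q) n ; _≟V_ = ≡-dec _≟ᶠ_
                     ; elems = allVecs n q ; adj = hamAdj }

module Submission where

-- Give the alphabet Z_q its additive structure and cut a word of length tn
-- into t blocks of length n.  The covering map is the block sum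
--   blockSum (x₁ ++ x₂ ++ … ++ x_t) = x₁ ⊕ x₂ ⊕ … ⊕ x_t .
-- A neighbour of v changes one letter of one block; since translation by the
-- other blocks is a bijection, the neighbours of v changing block i are sent
-- bijectively onto the neighbours of blockSum v in H(n,q).  Hence every
-- neighbour of blockSum v is hit exactly t times, which is the covering
-- condition for t·H(n,q).
--
-- Formally we count the "fibre degree" Σ_u [blockSum u = w]·adj(v,u) and show
-- that it equals t·adj(blockSum v, w) by induction on t, using that
-- H(n + m, q) is the Cartesian product H(n,q) □ H(m,q).

open import Defs
open import Data.Nat using (ℕ; _*_; _≥_; NonZero)
open import Data.Nat.Base using (zero; suc; _+_; _∸_; _%_; ≢-nonZero⁻¹)
open import Data.Nat.Properties using (+-identityʳ; +-assoc; +-comm; +-suc; m+[n∸m]≡n; m∸n+n≡m; <⇒≤; +-commutativeSemigroup)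
open import Data.Nat.DivMod using (_mod_; m%n<n; %-distribˡ-+; m%n%n≡m%n; m<n⇒m%n≡m; [m+n]%n≡m%n)
open import Data.Nat.ListAction using (sum)
open import Data.Nat.ListAction.Properties using (sum-++)
open import Algebra.Properties.CommutativeSemigroup +-commutativeSemigroup using (interchange)
open import Data.Fin.Base as Fin using (Fin; toℕ)
open import Data.Fin.Properties using (toℕ-injective; toℕ-fromℕ<; toℕ<n; suc-injective) renaming (_≟_ to _≟ᶠ_)
open import Data.Vec.Base using (Vec; []; _∷_; _++_; replicate; zipWith; take; drop)
open import Data.Vec.Properties using (≡-dec; ∷-injective; ++-injective; take++drop≡id; zipWith-comm; zipWith-identityʳ)
open import Data.List.Base as List using (List; []; _∷_; map; concatMap; allFin)
open import Data.List.Properties using (map-cong; map-++; map-∘; map-tabulate)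
open import Data.Product using (∃; _,_; proj₁; proj₂)
open import Data.Empty using (⊥-elim)
open import Function.Base using (_∘_; id)
open import Relation.Nullary using (Dec; yes; no; ¬_)
open import Relation.Binary.PropositionalEquality

Σ⟨_⟩_ : {A : Set} → List A → (A → ℕ) → ℕ
Σ⟨ xs ⟩ f = sum (map f xs)

Σ-cong : {A : Set} {f g : A → ℕ} (xs : List A) → (∀ x → f x ≡ g x) → Σ⟨ xs ⟩ f ≡ Σ⟨ xs ⟩ g
Σ-cong xs f≗g = cong sum (map-cong f≗g xs)

Σ-zero : {A : Set} {f : A → ℕ} (xs : List A) → (∀ x → f x ≡ 0) → Σ⟨ xs ⟩ f ≡ 0
Σ-zero []       f≡0 = refl
Σ-zero (x ∷ xs) f≡0 = cong₂ _+_ (f≡0 x) (Σ-zero xs f≡0)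

Σ-+ : {A : Set} (f g : A → ℕ) (xs : List A) → Σ⟨ xs ⟩ (λ x → f x + g x) ≡ Σ⟨ xs ⟩ f + Σ⟨ xs ⟩ g
Σ-+ f g []       = refl
Σ-+ f g (x ∷ xs) = trans (cong (f x + g x +_) (Σ-+ f g xs)) (interchange (f x) (g x) _ _)

Σ-concatMap : {A B : Set} (f : B → ℕ) (g : A → List B) (xs : List A) →
  Σ⟨ concatMap g xs ⟩ f ≡ Σ⟨ xs ⟩ (λ x → Σ⟨ g x ⟩ f)
Σ-concatMap f g []       = refl
Σ-concatMap f g (x ∷ xs) = begin
  sum (map f (g x List.++ concatMap g xs))          ≡⟨ cong sum (map-++ f (g x) (concatMap g xs)) ⟩
  sum (map f (g x) List.++ map f (concatMap g xs))  ≡⟨ sum-++ (map f (g x)) _ ⟩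
  Σ⟨ g x ⟩ f + Σ⟨ concatMap g xs ⟩ f                ≡⟨ cong (Σ⟨ g x ⟩ f +_) (Σ-concatMap f g xs) ⟩
  Σ⟨ g x ⟩ f + Σ⟨ xs ⟩ (λ y → Σ⟨ g y ⟩ f)           ∎
  where open ≡-Reasoning

Σ-map : {A B : Set} (f : B → ℕ) (g : A → B) (xs : List A) → Σ⟨ map g xs ⟩ f ≡ Σ⟨ xs ⟩ (f ∘ g)
Σ-map f g xs = cong sum (sym (map-∘ xs))

Σ-allFin-suc : ∀ {q} (f : Fin (suc q) → ℕ) → Σ⟨ allFin (suc q) ⟩ f ≡ f Fin.zero + Σ⟨ allFin q ⟩ (f ∘ Fin.suc)
Σ-allFin-suc f = cong (λ s → f Fin.zero + sum s)
  (trans (map-tabulate Fin.suc f) (sym (map-tabulate id (f ∘ Fin.suc))))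

Σ-allFin-point : ∀ {q} (c : Fin q) (f : Fin q → ℕ) → (∀ x → ¬ x ≡ c → f x ≡ 0) → Σ⟨ allFin q ⟩ f ≡ f c
Σ-allFin-point Fin.zero f vanish = begin
  Σ⟨ allFin _ ⟩ f                             ≡⟨ Σ-allFin-suc f ⟩
  f Fin.zero + Σ⟨ allFin _ ⟩ (f ∘ Fin.suc)    ≡⟨ cong (f Fin.zero +_) (Σ-zero (allFin _) (λ x → vanish (Fin.suc x) λ ())) ⟩
  f Fin.zero + 0                              ≡⟨ +-identityʳ _ ⟩
  f Fin.zero                                  ∎
  where open ≡-Reasoning
Σ-allFin-point (Fin.suc c) f vanish = trans (Σ-allFin-suc f) (cong₂ _+_ (vanish Fin.zero λ ())
  (Σ-allFin-point c (f ∘ Fin.suc) (λ x x≢c → vanish (Fin.suc x) (x≢c ∘ suc-injective))))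

Word : ℕ → ℕ → Set
Word q m = Vec (Fin q) m

Σʷ : ∀ {q} m → (Word q m → ℕ) → ℕ
Σʷ {q} m f = Σ⟨ allVecs m q ⟩ f

Σʷ-cong : ∀ {q} m {f g : Word q m → ℕ} → (∀ x → f x ≡ g x) → Σʷ m f ≡ Σʷ m g
Σʷ-cong {q} m = Σ-cong (allVecs m q)

Σʷ-+ : ∀ {q} m (f g : Word q m → ℕ) → Σʷ m (λ x → f x + g x) ≡ Σʷ m f + Σʷ m g
Σʷ-+ {q} m f g = Σ-+ f g (allVecs m q)

Σʷ-suc : ∀ {q} m (f : Word q (suc m) → ℕ) →
  Σʷ (suc m) f ≡ Σ⟨ allFin q ⟩ (λ x → Σʷ m (λ v → f (x ∷ v)))
Σʷ-suc {q} m f = trans (Σ-concatMap f (λ x → map (x ∷_) (allVecs m q)) (allFin q))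
                       (Σ-cong (allFin q) (λ x → Σ-map f (x ∷_) (allVecs m q)))

Σʷ-++ : ∀ {q} m k (f : Word q (m + k) → ℕ) → Σʷ (m + k) f ≡ Σʷ m (λ a → Σʷ k (λ b → f (a ++ b)))
Σʷ-++ zero    k f = sym (+-identityʳ _)
Σʷ-++ {q} (suc m) k f = begin
  Σʷ (suc m + k) f                                                   ≡⟨ Σʷ-suc (m + k) f ⟩
  Σ⟨ allFin q ⟩ (λ x → Σʷ (m + k) (λ v → f (x ∷ v)))                ≡⟨ Σ-cong (allFin q) (λ x → Σʷ-++ m k (λ v → f (x ∷ v))) ⟩
  Σ⟨ allFin q ⟩ (λ x → Σʷ m (λ a → Σʷ k (λ b → f (x ∷ a ++ b))))     ≡⟨ sym (Σʷ-suc m (λ a → Σʷ k (λ b → f (a ++ b)))) ⟩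
  Σʷ (suc m) (λ a → Σʷ k (λ b → f (a ++ b)))                         ∎
  where open ≡-Reasoning

Σʷ-point : ∀ {q} m (c : Word q m) (f : Word q m → ℕ) → (∀ x → ¬ x ≡ c → f x ≡ 0) → Σʷ m f ≡ f c
Σʷ-point zero    []       f vanish = +-identityʳ _
Σʷ-point (suc m) (c ∷ cs) f vanish = begin
  Σʷ (suc m) f                                     ≡⟨ Σʷ-suc m f ⟩
  Σ⟨ allFin _ ⟩ (λ x → Σʷ m (λ v → f (x ∷ v)))    ≡⟨ Σ-allFin-point c _ (λ x x≢c → Σ-zero (allVecs m _) (λ v → vanish (x ∷ v) (x≢c ∘ proj₁ ∘ ∷-injective))) ⟩
  Σʷ m (λ v → f (c ∷ v))                           ≡⟨ Σʷ-point m cs (λ v → f (c ∷ v)) (λ v v≢cs → vanish (c ∷ v) (v≢cs ∘ proj₂ ∘ ∷-injective)) ⟩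
  f (c ∷ cs)                                       ∎
  where open ≡-Reasoning

-- δ p w x = [p ≡ w]·x; it is exactly the summand of neighbourCount for
-- Hamming graphs.
δ : ∀ {q m} → Word q m → Word q m → ℕ → ℕ
δ p w x with ≡-dec _≟ᶠ_ p w
... | yes _ = x
... | no  _ = 0

δ-0 : ∀ {q m} (p w : Word q m) → δ p w 0 ≡ 0
δ-0 p w with ≡-dec _≟ᶠ_ p w
... | yes _ = refl
... | no  _ = refl

module _ {q m : ℕ} {p w : Word q m} where

  δ-≡ : ∀ {x} → p ≡ w → δ p w x ≡ x
  δ-≡ p≡w with ≡-dec _≟ᶠ_ p w
  ... | yes _   = refl
  ... | no  p≢w = ⊥-elim (p≢w p≡w)

  δ-≢ : ∀ {x} → ¬ p ≡ w → δ p w x ≡ 0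
  δ-≢ p≢w with ≡-dec _≟ᶠ_ p w
  ... | yes p≡w = ⊥-elim (p≢w p≡w)
  ... | no  _   = refl

δ-+ : ∀ {q m} (p w : Word q m) x y → δ p w (x + y) ≡ δ p w x + δ p w y
δ-+ p w x y with ≡-dec _≟ᶠ_ p w
... | yes _ = refl
... | no  _ = refl

δ-Σ : ∀ {q m} (p w : Word q m) {A : Set} (xs : List A) (f : A → ℕ) →
  Σ⟨ xs ⟩ (λ x → δ p w (f x)) ≡ δ p w (Σ⟨ xs ⟩ f)
δ-Σ p w xs f with ≡-dec _≟ᶠ_ p w
... | yes _ = refl
... | no  _ = Σ-zero xs (λ _ → refl)

δ-comm : ∀ {q m k} (p w : Word q m) (p′ w′ : Word q k) x → δ p w (δ p′ w′ x) ≡ δ p′ w′ (δ p w x)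
δ-comm p w p′ w′ x with ≡-dec _≟ᶠ_ p w
... | yes _ = refl
... | no  _ = sym (δ-0 p′ w′)

Σʷ-δ : ∀ {q} m (c : Word q m) (f : Word q m → ℕ) → Σʷ m (λ x → δ x c (f x)) ≡ f c
Σʷ-δ m c f = trans (Σʷ-point m c _ (λ x x≢c → δ-≢ x≢c)) (δ-≡ refl)

hdist-refl : ∀ {q m} (x : Word q m) → hdist x x ≡ 0
hdist-refl []       = refl
hdist-refl (x ∷ xs) with x ≟ᶠ x
... | yes _   = hdist-refl xs
... | no  x≢x = ⊥-elim (x≢x refl)

hdist≡0⇒≡ : ∀ {q m} (x y : Word q m) → hdist x y ≡ 0 → x ≡ y
hdist≡0⇒≡ []       []       _ = refl
hdist≡0⇒≡ (x ∷ xs) (y ∷ ys) d≡0 with x ≟ᶠ y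
... | yes x≡y = cong₂ _∷_ x≡y (hdist≡0⇒≡ xs ys d≡0)
... | no  _   with () ← d≡0

hdist-++ : ∀ {q m k} (a a′ : Word q m) (b b′ : Word q k) →
  hdist (a ++ b) (a′ ++ b′) ≡ hdist a a′ + hdist b b′
hdist-++ []      []        b b′ = refl
hdist-++ (x ∷ a) (y ∷ a′) b b′ with x ≟ᶠ y
... | yes _ = hdist-++ a a′ b b′
... | no  _ = cong suc (hdist-++ a a′ b b′)

isOne : ℕ → ℕ
isOne 1 = 1
isOne _ = 0

isOne-+ : ∀ x y → ¬ x ≡ 0 → ¬ y ≡ 0 → isOne (x + y) ≡ 0
isOne-+ zero    _       x≢0 _   = ⊥-elim (x≢0 refl)
isOne-+ (suc x) zero    _   y≢0 = ⊥-elim (y≢0 refl)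
isOne-+ (suc x) (suc y) _   _   rewrite +-suc x y = refl

hamAdj≡isOne : ∀ {q m} (u v : Word q m) → hamAdj u v ≡ isOne (hdist u v)
hamAdj≡isOne u v with hdist u v
... | zero        = refl
... | suc zero    = refl
... | suc (suc _) = refl

hamAdj-via-hdist : ∀ {q m k} (u v : Word q m) (u′ v′ : Word q k) →
  hdist u v ≡ hdist u′ v′ → hamAdj u v ≡ hamAdj u′ v′
hamAdj-via-hdist u v u′ v′ d≡d′ =
  trans (hamAdj≡isOne u v) (trans (cong isOne d≡d′) (sym (hamAdj≡isOne u′ v′)))

hamAdj-dist0 : ∀ {q m} (u v : Word q m) → hdist u v ≡ 0 → hamAdj u v ≡ 0
hamAdj-dist0 u v d≡0 = trans (hamAdj≡isOne u v) (cong isOne d≡0)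

-- H(m + k, q) is the Cartesian product H(m,q) □ H(k,q): two concatenations
-- are adjacent iff one half agrees and the other half is adjacent.
hamAdj-++ : ∀ {q m k} (a a′ : Word q m) (b b′ : Word q k) →
  hamAdj (a ++ b) (a′ ++ b′) ≡ δ b′ b (hamAdj a a′) + δ a′ a (hamAdj b b′)
hamAdj-++ {q} {m} {k} a a′ b b′ = byCases (≡-dec _≟ᶠ_ a′ a) (≡-dec _≟ᶠ_ b′ b)
  where
  open ≡-Reasoning
  dist-a dist-b : ℕ
  dist-a = hdist a a′
  dist-b = hdist b b′
  splitDist : hdist (a ++ b) (a′ ++ b′) ≡ dist-a + dist-b
  splitDist = hdist-++ a a′ b b′
  equalDist : ∀ {l} {x y : Word q l} → y ≡ x → hdist x y ≡ 0
  equalDist {x = x} refl = hdist-refl x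

  byCases : Dec (a′ ≡ a) → Dec (b′ ≡ b) →
    hamAdj (a ++ b) (a′ ++ b′) ≡ δ b′ b (hamAdj a a′) + δ a′ a (hamAdj b b′)
  byCases (yes a′≡a) (yes b′≡b) = begin
    hamAdj (a ++ b) (a′ ++ b′)                  ≡⟨ hamAdj-dist0 (a ++ b) (a′ ++ b′) (trans splitDist (cong₂ _+_ (equalDist a′≡a) (equalDist b′≡b))) ⟩
    0 + 0                                       ≡⟨ sym (cong₂ _+_ (hamAdj-dist0 a a′ (equalDist a′≡a)) (hamAdj-dist0 b b′ (equalDist b′≡b))) ⟩
    hamAdj a a′ + hamAdj b b′                   ≡⟨ sym (cong₂ _+_ (δ-≡ b′≡b) (δ-≡ a′≡a)) ⟩
    δ b′ b (hamAdj a a′) + δ a′ a (hamAdj b b′) ∎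
  byCases (yes a′≡a) (no b′≢b) = begin
    hamAdj (a ++ b) (a′ ++ b′)                  ≡⟨ hamAdj-via-hdist (a ++ b) (a′ ++ b′) b b′ (trans splitDist (cong (_+ dist-b) (equalDist a′≡a))) ⟩
    hamAdj b b′                                 ≡⟨ sym (cong₂ _+_ (δ-≢ b′≢b) (δ-≡ a′≡a)) ⟩
    δ b′ b (hamAdj a a′) + δ a′ a (hamAdj b b′) ∎
  byCases (no a′≢a) (yes b′≡b) = begin
    hamAdj (a ++ b) (a′ ++ b′)                  ≡⟨ hamAdj-via-hdist (a ++ b) (a′ ++ b′) a a′ (trans splitDist (trans (cong (dist-a +_) (equalDist b′≡b)) (+-identityʳ _))) ⟩
    hamAdj a a′                                 ≡⟨ sym (trans (cong₂ _+_ (δ-≡ b′≡b) (δ-≢ a′≢a)) (+-identityʳ _)) ⟩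
    δ b′ b (hamAdj a a′) + δ a′ a (hamAdj b b′) ∎
  byCases (no a′≢a) (no b′≢b) = begin
    hamAdj (a ++ b) (a′ ++ b′)                  ≡⟨ trans (hamAdj≡isOne (a ++ b) (a′ ++ b′)) (cong isOne splitDist) ⟩
    isOne (dist-a + dist-b)                     ≡⟨ isOne-+ _ _ (a′≢a ∘ sym ∘ hdist≡0⇒≡ a a′) (b′≢b ∘ sym ∘ hdist≡0⇒≡ b b′) ⟩
    0                                           ≡⟨ sym (cong₂ _+_ (δ-≢ b′≢b) (δ-≢ a′≢a)) ⟩
    δ b′ b (hamAdj a a′) + δ a′ a (hamAdj b b′) ∎

-- Abelian groups (in
-- particular Z_q) are examples; the block-sum map works for any of them.
record CommutativeLoop (A : Set) : Set where
  infixl 6 _⊕_ _⊖_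
  field
    _⊕_ _⊖_     : A → A → A
    ε           : A
    ⊕-comm      : ∀ x y → x ⊕ y ≡ y ⊕ x
    ⊕-identityʳ : ∀ x → x ⊕ ε ≡ x
    ⊖-⊕         : ∀ y z → y ⊖ z ⊕ z ≡ y
    ⊕-⊖         : ∀ x z → x ⊕ z ⊖ z ≡ x

  solve : ∀ {x y z} → x ⊕ z ≡ y → x ≡ y ⊖ z
  solve {x} {y} {z} x⊕z≡y = trans (sym (⊕-⊖ x z)) (cong (_⊖ z) x⊕z≡y)

  unsolve : ∀ {x y z} → x ≡ y ⊖ z → x ⊕ z ≡ y
  unsolve {x} {y} {z} x≡y⊖z = trans (cong (_⊕ z) x≡y⊖z) (⊖-⊕ y z)

wordLoop : ∀ {A m} → CommutativeLoop A → CommutativeLoop (Vec A m)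
wordLoop {A} L = record
  { _⊕_ = zipWith _⊕_ ; _⊖_ = zipWith _⊖_ ; ε = replicate _ ε
  ; ⊕-comm = zipWith-comm ⊕-comm
  ; ⊕-identityʳ = zipWith-identityʳ ⊕-identityʳ
  ; ⊖-⊕ = ⊖-⊕ʷ ; ⊕-⊖ = ⊕-⊖ʷ }
  where
  open CommutativeLoop L
  ⊖-⊕ʷ : ∀ {m} (y z : Vec A m) → zipWith _⊕_ (zipWith _⊖_ y z) z ≡ y
  ⊖-⊕ʷ []       []       = refl
  ⊖-⊕ʷ (y ∷ ys) (z ∷ zs) = cong₂ _∷_ (⊖-⊕ y z) (⊖-⊕ʷ ys zs)
  ⊕-⊖ʷ : ∀ {m} (x z : Vec A m) → zipWith _⊖_ (zipWith _⊕_ x z) z ≡ x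
  ⊕-⊖ʷ []       []       = refl
  ⊕-⊖ʷ (x ∷ xs) (z ∷ zs) = cong₂ _∷_ (⊕-⊖ x z) (⊕-⊖ʷ xs zs)

module Translation {q} (L : CommutativeLoop (Fin q)) where
  open CommutativeLoop L
  open module W {m : ℕ} = CommutativeLoop (wordLoop {m = m} L)
    using () renaming (_⊕_ to _⊕ʷ_; _⊖_ to _⊖ʷ_; solve to solveʷ; unsolve to unsolveʷ; ⊕-comm to ⊕ʷ-comm)

  hdist-translate : ∀ {m} (a b c : Word q m) → hdist (a ⊕ʷ c) (b ⊕ʷ c) ≡ hdist a b
  hdist-translate []       []       []       = refl
  hdist-translate (x ∷ xs) (y ∷ ys) (z ∷ zs) with (x ⊕ z) ≟ᶠ (y ⊕ z) | x ≟ᶠ y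
  ... | yes _    | yes _   = hdist-translate xs ys zs
  ... | no  _    | no  _   = cong suc (hdist-translate xs ys zs)
  ... | yes x⊕z≡y⊕z | no x≢y = ⊥-elim (x≢y (trans (solve x⊕z≡y⊕z) (⊕-⊖ y z)))
  ... | no x⊕z≢y⊕z  | yes refl = ⊥-elim (x⊕z≢y⊕z refl)

  hamAdj-translate : ∀ {m} (a w c : Word q m) → hamAdj a (w ⊖ʷ c) ≡ hamAdj (a ⊕ʷ c) w
  hamAdj-translate a w c = hamAdj-via-hdist a (w ⊖ʷ c) (a ⊕ʷ c) w (begin
    hdist a (w ⊖ʷ c)                 ≡⟨ sym (hdist-translate a (w ⊖ʷ c) c) ⟩
    hdist (a ⊕ʷ c) (w ⊖ʷ c ⊕ʷ c)     ≡⟨ cong (hdist (a ⊕ʷ c)) (unsolveʷ refl) ⟩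
    hdist (a ⊕ʷ c) w                 ∎)
    where open ≡-Reasoning

  δ-translate : ∀ {m} (a p w : Word q m) x → δ (a ⊕ʷ p) w x ≡ δ p (w ⊖ʷ a) x
  δ-translate a p w x with ≡-dec _≟ᶠ_ p (w ⊖ʷ a)
  ... | yes p≡w⊖a = δ-≡ (trans (⊕ʷ-comm a p) (unsolveʷ p≡w⊖a))
  ... | no  p≢w⊖a = δ-≢ (p≢w⊖a ∘ solveʷ ∘ trans (⊕ʷ-comm p a))

module ModularArithmetic (q′ : ℕ) where
  Q : ℕ
  Q = suc q′

  shift : ℕ → Fin Q → Fin Q
  shift k x = (toℕ x + k) mod Q

  toℕ-shift : ∀ k x → toℕ (shift k x) ≡ (toℕ x + k) % Q
  toℕ-shift k x = toℕ-fromℕ< (m%n<n (toℕ x + k) Q)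

  %-absorbˡ : ∀ m k → (m % Q + k) % Q ≡ (m + k) % Q
  %-absorbˡ m k = begin
    (m % Q + k) % Q              ≡⟨ %-distribˡ-+ (m % Q) k Q ⟩
    (m % Q % Q + k % Q) % Q      ≡⟨ cong (λ r → (r + k % Q) % Q) (m%n%n≡m%n m Q) ⟩
    (m % Q + k % Q) % Q          ≡⟨ sym (%-distribˡ-+ m k Q) ⟩
    (m + k) % Q                  ∎
    where open ≡-Reasoning

  shift-shift : ∀ {k l} → k + l ≡ Q → ∀ x → shift l (shift k x) ≡ x
  shift-shift {k} {l} k+l≡Q x = toℕ-injective (begin
    toℕ (shift l (shift k x))     ≡⟨ toℕ-shift l (shift k x) ⟩
    (toℕ (shift k x) + l) % Q     ≡⟨ cong (λ r → (r + l) % Q) (toℕ-shift k x) ⟩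
    ((toℕ x + k) % Q + l) % Q     ≡⟨ %-absorbˡ (toℕ x + k) l ⟩
    (toℕ x + k + l) % Q           ≡⟨ cong (_% Q) (trans (+-assoc (toℕ x) k l) (cong (toℕ x +_) k+l≡Q)) ⟩
    (toℕ x + Q) % Q               ≡⟨ [m+n]%n≡m%n (toℕ x) Q ⟩
    toℕ x % Q                     ≡⟨ m<n⇒m%n≡m (toℕ<n x) ⟩
    toℕ x                         ∎)
    where open ≡-Reasoning

  ℤ-mod : CommutativeLoop (Fin Q)
  ℤ-mod = record
    { _⊕_ = λ x y → shift (toℕ y) x
    ; _⊖_ = λ y z → shift (Q ∸ toℕ z) y
    ; ε = Fin.zero
    ; ⊕-comm = λ x y → cong (_mod Q) (+-comm (toℕ x) (toℕ y))
    ; ⊕-identityʳ = λ x → toℕ-injective (trans (toℕ-shift 0 x)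
                      (trans (cong (_% Q) (+-identityʳ (toℕ x))) (m<n⇒m%n≡m (toℕ<n x))))
    ; ⊖-⊕ = λ y z → shift-shift (m∸n+n≡m (<⇒≤ (toℕ<n z))) y
    ; ⊕-⊖ = λ x z → shift-shift (m+[n∸m]≡n (<⇒≤ (toℕ<n z))) x
    }

module BlockSum {q} (L : CommutativeLoop (Fin q)) (n : ℕ) where
  open CommutativeLoop (wordLoop {m = n} L)
  open CommutativeLoop L using () renaming (ε to ε₀)
  open Translation L

  blockSum : ∀ t → Word q (t * n) → Word q n
  blockSum zero    _ = ε
  blockSum (suc t) v = take n v ⊕ blockSum t (drop n v)

  blockSum-++ : ∀ t (a : Word q n) (b : Word q (t * n)) → blockSum (suc t) (a ++ b) ≡ a ⊕ blockSum t b
  blockSum-++ t a b = cong₂ _⊕_ take≡a (cong (blockSum t) drop≡b)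
    where
    take≡a : take n (a ++ b) ≡ a
    take≡a = proj₁ (++-injective (take n (a ++ b)) a (take++drop≡id n (a ++ b)))
    drop≡b : drop n (a ++ b) ≡ b
    drop≡b = proj₂ (++-injective (take n (a ++ b)) a (take++drop≡id n (a ++ b)))

  blockSum-ε : ∀ t → blockSum t (replicate (t * n) ε₀) ≡ ε
  blockSum-ε zero    = refl
  blockSum-ε (suc t) = begin
    blockSum (suc t) (replicate (n + t * n) ε₀)     ≡⟨ cong (blockSum (suc t)) (replicate-++ n (t * n)) ⟩
    blockSum (suc t) (ε ++ replicate (t * n) ε₀)    ≡⟨ blockSum-++ t ε _ ⟩
    ε ⊕ blockSum t (replicate (t * n) ε₀)           ≡⟨ cong (ε ⊕_) (blockSum-ε t) ⟩
    ε ⊕ ε                                           ≡⟨ ⊕-identityʳ ε ⟩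
    ε                                               ∎
    where
    open ≡-Reasoning
    replicate-++ : ∀ k l → replicate (k + l) ε₀ ≡ replicate k ε₀ ++ replicate l ε₀
    replicate-++ zero    l = refl
    replicate-++ (suc k) l = cong (ε₀ ∷_) (replicate-++ k l)

  blockSum-surjective : ∀ t (w : Word q n) → ∃ λ v → blockSum (suc t) v ≡ w
  blockSum-surjective t w = w ++ replicate (t * n) ε₀ ,
    trans (blockSum-++ t w _) (trans (cong (w ⊕_) (blockSum-ε t)) (⊕-identityʳ w))

  fibreDegree : ∀ t → Word q (t * n) → Word q n → ℕ
  fibreDegree t v w = Σʷ (t * n) (λ u → δ (blockSum t u) w (hamAdj v u))

  -- Neighbours of a ++ b changing the first block contribute adj(a ⊕ p, w),
  -- those changing a later block contribute the fibre degree of b at w ⊖ a.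
  fibreDegree-step : ∀ t (a : Word q n) (b : Word q (t * n)) w →
    fibreDegree (suc t) (a ++ b) w ≡ hamAdj (a ⊕ blockSum t b) w + fibreDegree t b (w ⊖ a)
  fibreDegree-step t a b w = begin
    fibreDegree (suc t) (a ++ b) w
      ≡⟨ Σʷ-++ n (t * n) _ ⟩
    Σʷ n (λ a′ → Σʷ (t * n) (λ b′ → δ (blockSum (suc t) (a′ ++ b′)) w (hamAdj (a ++ b) (a′ ++ b′))))
      ≡⟨ Σʷ-cong n (λ a′ → Σʷ-cong (t * n) (λ b′ → splitSummand a′ b′)) ⟩
    Σʷ n (λ a′ → Σʷ (t * n) (λ b′ → firstBlock a′ b′ + laterBlocks a′ b′))
      ≡⟨ Σʷ-cong n (λ a′ → Σʷ-+ (t * n) (firstBlock a′) (laterBlocks a′)) ⟩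
    Σʷ n (λ a′ → Σʷ (t * n) (firstBlock a′) + Σʷ (t * n) (laterBlocks a′))
      ≡⟨ Σʷ-+ n _ _ ⟩
    Σʷ n (λ a′ → Σʷ (t * n) (firstBlock a′)) + Σʷ n (λ a′ → Σʷ (t * n) (laterBlocks a′))
      ≡⟨ cong₂ _+_ firstBlock-total laterBlocks-total ⟩
    hamAdj (a ⊕ p) w + fibreDegree t b (w ⊖ a)
      ∎
    where
    open ≡-Reasoning
    p : Word q n
    p = blockSum t b
    firstBlock laterBlocks : Word q n → Word q (t * n) → ℕ
    firstBlock  a′ b′ = δ (a′ ⊕ blockSum t b′) w (δ b′ b (hamAdj a a′))
    laterBlocks a′ b′ = δ (a′ ⊕ blockSum t b′) w (δ a′ a (hamAdj b b′))

    splitSummand : ∀ a′ b′ → δ (blockSum (suc t) (a′ ++ b′)) w (hamAdj (a ++ b) (a′ ++ b′))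
                             ≡ firstBlock a′ b′ + laterBlocks a′ b′
    splitSummand a′ b′ = trans (cong₂ (λ s h → δ s w h) (blockSum-++ t a′ b′) (hamAdj-++ a a′ b b′))
                               (δ-+ (a′ ⊕ blockSum t b′) w _ _)

    firstBlock-total : Σʷ n (λ a′ → Σʷ (t * n) (firstBlock a′)) ≡ hamAdj (a ⊕ p) w
    firstBlock-total = begin
      Σʷ n (λ a′ → Σʷ (t * n) (firstBlock a′))
        ≡⟨ Σʷ-cong n (λ a′ → trans (Σʷ-cong (t * n) (λ b′ → δ-comm (a′ ⊕ blockSum t b′) w b′ b _))
                                    (Σʷ-δ (t * n) b _)) ⟩
      Σʷ n (λ a′ → δ (a′ ⊕ p) w (hamAdj a a′))
        ≡⟨ Σʷ-cong n (λ a′ → trans (cong (λ s → δ s w _) (⊕-comm a′ p)) (δ-translate p a′ w _)) ⟩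
      Σʷ n (λ a′ → δ a′ (w ⊖ p) (hamAdj a a′))
        ≡⟨ Σʷ-δ n (w ⊖ p) (hamAdj a) ⟩
      hamAdj a (w ⊖ p)
        ≡⟨ hamAdj-translate a w p ⟩
      hamAdj (a ⊕ p) w
        ∎

    laterBlocks-total : Σʷ n (λ a′ → Σʷ (t * n) (laterBlocks a′)) ≡ fibreDegree t b (w ⊖ a)
    laterBlocks-total = begin
      Σʷ n (λ a′ → Σʷ (t * n) (laterBlocks a′))
        ≡⟨ Σʷ-cong n (λ a′ → trans (Σʷ-cong (t * n) (λ b′ → δ-comm (a′ ⊕ blockSum t b′) w a′ a _))
                                    (δ-Σ a′ a (allVecs (t * n) q) _)) ⟩
      Σʷ n (λ a′ → δ a′ a (Σʷ (t * n) (λ b′ → δ (a′ ⊕ blockSum t b′) w (hamAdj b b′))))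
        ≡⟨ Σʷ-δ n a _ ⟩
      Σʷ (t * n) (λ b′ → δ (a ⊕ blockSum t b′) w (hamAdj b b′))
        ≡⟨ Σʷ-cong (t * n) (λ b′ → δ-translate a (blockSum t b′) w _) ⟩
      fibreDegree t b (w ⊖ a)
        ∎

  fibreDegree-formula : ∀ t v w → fibreDegree t v w ≡ t * hamAdj (blockSum t v) w
  fibreDegree-formula zero    []  w = trans (+-identityʳ _) (δ-0 ε w)
  fibreDegree-formula (suc t) v   w =
    subst (λ v → fibreDegree (suc t) v w ≡ suc t * hamAdj (blockSum (suc t) v) w)
          (take++drop≡id n v) (formula-++ (take n v) (drop n v))
    where
    open ≡-Reasoning
    formula-++ : ∀ a b → fibreDegree (suc t) (a ++ b) w ≡ suc t * hamAdj (blockSum (suc t) (a ++ b)) w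
    formula-++ a b = begin
      fibreDegree (suc t) (a ++ b) w                          ≡⟨ fibreDegree-step t a b w ⟩
      hamAdj (a ⊕ p) w + fibreDegree t b (w ⊖ a)              ≡⟨ cong (hamAdj (a ⊕ p) w +_) (fibreDegree-formula t b (w ⊖ a)) ⟩
      hamAdj (a ⊕ p) w + t * hamAdj p (w ⊖ a)                 ≡⟨ cong (λ h → hamAdj (a ⊕ p) w + t * h) translated ⟩
      suc t * hamAdj (a ⊕ p) w                                ≡⟨ cong (λ s → suc t * hamAdj s w) (sym (blockSum-++ t a b)) ⟩
      suc t * hamAdj (blockSum (suc t) (a ++ b)) w            ∎
      where
      p : Word q n
      p = blockSum t b
      translated : hamAdj p (w ⊖ a) ≡ hamAdj (a ⊕ p) w
      translated = trans (hamAdj-translate p w a) (cong (λ s → hamAdj s w) (⊕-comm p a))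

neighbourCount-Hamming : ∀ {q m n} s (φ : Word q m → Word q n) v w →
  neighbourCount (Hamming m q) (s · Hamming n q) φ v w ≡ Σʷ m (λ u → δ (φ u) w (hamAdj v u))
neighbourCount-Hamming {q} {m} {n} s φ v w = trans unfold (Σ-cong (allVecs m q) summand≡δ)
  where
  -- neighbourCount sums an anonymous local function; `unfold` exposes it
  -- under the name summand (its body is fixed by unification with refl).
  summand : Word q m → ℕ
  summand = _
  unfold : neighbourCount (Hamming m q) (s · Hamming n q) φ v w ≡ Σ⟨ allVecs m q ⟩ summand
  unfold = refl
  summand≡δ : ∀ u → summand u ≡ δ (φ u) w (hamAdj v u)
  summand≡δ u with ≡-dec _≟ᶠ_ (φ u) w
  ... | yes _ = refl
  ... | no  _ = refl

-- The block sum over Z_q is the covering map: it is onto because t ≥ 1, and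
-- its neighbour counts are t times the adjacencies of H(n,q).
proposition6 : (n t q : ℕ) → .{{_ : NonZero n}} → .{{_ : NonZero t}} → q ≥ 2 →
    Covers (Hamming (t * n) q) (t · Hamming n q)
proposition6 n zero    q        _  = ⊥-elim (≢-nonZero⁻¹ zero refl)
proposition6 n (suc t) zero     ()
proposition6 n (suc t) (suc q′) _  =
  blockSum (suc t) , blockSum-surjective t , λ v w →
    trans (neighbourCount-Hamming (suc t) (blockSum (suc t)) v w) (fibreDegree-formula (suc t) v w)
  where
  open ModularArithmetic q′
  open BlockSum ℤ-mod n
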